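{- For every positive integer $n$, there exists a connected finite simple graph $G$ such that $\det(G)=2n$ and $\det'(G)=n$.
   Context: A vertex set $S$ is a vertex determining set if the only automorphism fixing every vertex of $S$ is the identity; $\det(G)$ is the minimum size of such a set. For a graph with at most one isolated vertex and no $K_2$ component, an edge set $T$ is an edge determining set if the only automorphism $\phi$ with $\{\phi(u),\phi(v)\}=\{u,v\}$ for all $\{u,v\}\in T$ is the identity; $\det'(G)$ is the minimum size of such a set. -}

module Defs where

open import Data.Nat using (ℕ; _≤_)
open import Data.Fin using (Fin)
open import Data.Bool using (Bool; true; false)
open import Data.List using (List; length)
open import Data.List.Relation.Unary.All using (All)
open import Data.Product using (_×_; Σ; ∃; _,_)
open import Data.Sum using (_⊎_)
open import Relation.Binary.PropositionalEquality using (_≡_)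
open import Relation.Nullary using (¬_)

record Graph : Set where
  field
    order  : ℕ
    adj    : Fin order → Fin order → Bool
    sym    : ∀ x y → adj x y ≡ adj y x
    irrefl : ∀ x → adj x x ≡ false
open Graph public

module _ (G : Graph) where

  Adj : Fin (order G) → Fin (order G) → Set
  Adj x y = adj G x y ≡ true

  data Walk : Fin (order G) → Fin (order G) → Set where
    here : ∀ {x} → Walk x x
    step : ∀ {x y z} → Adj x y → Walk y z → Walk x z

  Connected : Set
  Connected = Fin (order G) × (∀ x y → Walk x y)

  record Aut : Set where
    field
      fun     : Fin (order G) → Fin (order G)
      inv     : Fin (order G) → Fin (order G)
      inv-l   : ∀ x → inv (fun x) ≡ x
      inv-r   : ∀ x → fun (inv x) ≡ x
      preserv : ∀ x y → adj G (fun x) (fun y) ≡ adj G x y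
  open Aut public

  IsIdentity : Aut → Set
  IsIdentity φ = ∀ x → fun φ x ≡ x

  -- vertex sets are given as lists (duplicates do not affect the minimum)
  VertexDetermining : List (Fin (order G)) → Set
  VertexDetermining S = ∀ (φ : Aut) → All (λ x → fun φ x ≡ x) S → IsIdentity φ

  DetEq : ℕ → Set
  DetEq k = (Σ (List (Fin (order G))) λ S → VertexDetermining S × length S ≡ k)
          × (∀ S → VertexDetermining S → k ≤ length S)

  -- an edge is given by an ordered pair of adjacent vertices {u,v}
  Edge : Set
  Edge = Σ (Fin (order G) × Fin (order G)) λ { (u , v) → Adj u v }

  FixesEdge : Aut → Edge → Set
  FixesEdge φ ((u , v) , _) =
    (fun φ u ≡ u × fun φ v ≡ v) ⊎ (fun φ u ≡ v × fun φ v ≡ u)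

  EdgeDetermining : List Edge → Set
  EdgeDetermining T = ∀ (φ : Aut) → All (FixesEdge φ) T → IsIdentity φ

  EdgeDetEq : ℕ → Set
  EdgeDetEq k = (Σ (List Edge) λ T → EdgeDetermining T × length T ≡ k)
              × (∀ T → EdgeDetermining T → k ≤ length T)

  Isolated : Fin (order G) → Set
  Isolated x = ∀ y → adj G x y ≡ false

  K2Component : Fin (order G) → Fin (order G) → Set
  K2Component x y = Adj x y × (∀ z → Adj x z → z ≡ y) × (∀ z → Adj y z → z ≡ x)

  -- standing hypothesis under which det' is defined
  EdgeDetAdmissible : Set
  EdgeDetAdmissible = (∀ x y → Isolated x → Isolated y → x ≡ y)
                    × (∀ x y → ¬ K2Component x y)

-- G is a hub joined to m = n + 1 gadgets; gadget i is the 4-cycle a₁ b₁ a₂ b₂ together with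
-- the paths a₁ c₁ hub and a₂ c₂ hub. Each gadget carries two involutions, b₁ ↔ b₂ and
-- (a₁ ↔ a₂, c₁ ↔ c₂), and these 2m automorphisms have pairwise disjoint supports; by pigeonhole a
-- determining vertex set must meet all 2m supports and a determining edge set must meet, for every
-- gadget, an edge at b₁ or b₂. Conversely, an automorphism fixing a₁ and b₁ in every gadget is the
-- identity (chase neighbourhoods from a₁, b₁), and fixing the edge a₁b₁ already fixes both ends,
-- because a₁ has degree 3 and b₁ degree 2.

module Submission where

open import Defs hiding (sym)
open import Data.Nat using (ℕ; suc; _+_; _*_; _≤_; _<_)
import Data.Nat as ℕ
open import Data.Nat.Properties using (_<?_; ≮⇒≥; +-identityʳ)
open import Data.Fin using (Fin; zero; suc; toℕ; combine; remQuot; splitAt)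
open import Data.Fin.Patterns using (0F; 1F; 2F; 3F; 4F; 5F)
open import Data.Fin.Properties
  using ( _≟_; pigeonhole; ¬∀⟶∃¬; toℕ-injective; <⇒≢; remQuot-combine; combine-remQuot
        ; toℕ-↑ˡ; toℕ-↑ʳ; splitAt⁻¹-↑ˡ; splitAt⁻¹-↑ʳ)
open import Data.Bool using (Bool; true; false; _∧_)
open import Data.Bool.Properties using (∧-zeroʳ; ∧-identityʳ)
open import Data.Empty using (⊥)
open import Data.List using (List; length; lookup; tabulate; _++_)
open import Data.List.Properties using (length-++; length-tabulate)
open import Data.List.Relation.Unary.All as All using (All)
open import Data.List.Relation.Unary.All.Properties using (¬Any⇒All¬; tabulate⁻; ++⁻ˡ; ++⁻ʳ)
open import Data.List.Relation.Unary.Any using (Any; any?; index)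
open import Data.List.Relation.Unary.Any.Properties using (lookup-index)
open import Data.Product using (Σ; ∃; ∃₂; _×_; _,_; uncurry; proj₁; proj₂)
import Data.Product as Product
open import Data.Sum using (_⊎_; inj₁; inj₂)
open import Function using (_∘_)
open import Function.Bundles using (_↔_; mk↔ₛ′; Inverse)
open import Relation.Nullary using (¬_; yes; no; does; contradiction)
open import Relation.Binary.PropositionalEquality

missed-class : ∀ {X : Set} {k} (class : X → ℕ) (L : List X) → length L < k →
               ∃ λ (j : Fin k) → All (λ x → class x ≢ toℕ j) L
missed-class {k = k} class L |L|<k =
  Product.map₂ (¬Any⇒All¬ L) (¬∀⟶∃¬ k _ (λ j → any? (λ x → class x ℕ.≟ toℕ j) L) not-all-hit)
  where
  not-all-hit : ¬ (∀ j → Any (λ x → class x ≡ toℕ j) L)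
  not-all-hit hit with pigeonhole |L|<k (λ j → index (hit j))
  ... | i , j , i<j , same-index = <⇒≢ i<j (toℕ-injective (begin
    toℕ i                            ≡⟨ sym (lookup-index (hit i)) ⟩
    class (lookup L (index (hit i))) ≡⟨ cong (λ p → class (lookup L p)) same-index ⟩
    class (lookup L (index (hit j))) ≡⟨ lookup-index (hit j) ⟩
    toℕ j                            ∎))
    where open ≡-Reasoning

module _ (G : Graph) where

  _++ʷ_ : ∀ {x y z} → Walk G x y → Walk G y z → Walk G x z
  here       ++ʷ w′ = w′
  step xy w  ++ʷ w′ = step xy (w ++ʷ w′)

  reverse : ∀ {x y} → Walk G x y → Walk G y x
  reverse here                = here
  reverse (step {x} {y} xy w) = reverse w ++ʷ step (trans (Graph.sym G y x) xy) here

  connected-via : (r : Fin (order G)) → (∀ x → Walk G x r) → Connected G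
  connected-via r to-r = r , λ x y → to-r x ++ʷ reverse (to-r y)

  admissible-if-two-neighbours :
    (∀ x → ∃₂ λ y z → Adj G x y × Adj G x z × y ≢ z) → EdgeDetAdmissible G
  admissible-if-two-neighbours nbrs = no-isolated , no-K2
    where
    no-isolated : ∀ x y → Isolated G x → Isolated G y → x ≡ y
    no-isolated x _ x-isolated _ with nbrs x
    ... | y , _ , xy , _ = contradiction (trans (sym xy) (x-isolated y)) λ ()

    no-K2 : ∀ x y → ¬ K2Component G x y
    no-K2 x _ (_ , only-y , _) with nbrs x
    ... | y , z , xy , xz , y≢z = y≢z (trans (only-y y xy) (sym (only-y z xz)))

  determining-lower-bound :
    ∀ {X : Set} (Fixes : Aut G → X → Set) (class : X → ℕ) k →
    (∀ (j : Fin k) → Σ (Aut G) λ α → ¬ IsIdentity G α × (∀ x → class x ≢ toℕ j → Fixes α x)) →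
    ∀ L → (∀ α → All (Fixes α) L → IsIdentity G α) → k ≤ length L
  determining-lower-bound Fixes class k moves L determining with length L <? k
  ... | no |L|≮k = ≮⇒≥ |L|≮k
  ... | yes |L|<k with missed-class class L |L|<k
  ... | j , avoided with moves j
  ... | α , non-identity , fixes =
    contradiction (determining α (All.map (λ {x} → fixes x) avoided)) non-identity

module FiniteGraph {V : Set} {n : ℕ} (code : V ↔ Fin n) (_~_ : V → V → Bool)
                   (~-sym : ∀ u v → u ~ v ≡ v ~ u) (~-irrefl : ∀ u → u ~ u ≡ false) where

  open Inverse code public using ()
    renaming (to to enc; from to dec; strictlyInverseˡ to enc-dec; strictlyInverseʳ to dec-enc)

  graph : Graph
  graph = record
    { order  = n
    ; adj    = λ x y → dec x ~ dec y
    ; sym    = λ x y → ~-sym (dec x) (dec y)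
    ; irrefl = λ x → ~-irrefl (dec x)
    }

  enc-injective : ∀ {u v} → enc u ≡ enc v → u ≡ v
  enc-injective {u} {v} eq = trans (sym (dec-enc u)) (trans (cong dec eq) (dec-enc v))

  adj-enc : ∀ x v → dec x ~ v ≡ true → Adj graph x (enc v)
  adj-enc x v xv = trans (cong (dec x ~_) (dec-enc v)) xv

  edge : ∀ {u v} → u ~ v ≡ true → Adj graph (enc u) (enc v)
  edge {u} {v} uv = adj-enc (enc u) v (trans (cong (_~ v) (dec-enc u)) uv)

  via : ∀ u v {z} → u ~ v ≡ true → Walk graph (enc v) z → Walk graph (enc u) z
  via u v uv = step (edge {u} {v} uv)

  edge-of : ∀ u v → u ~ v ≡ true → Edge graph
  edge-of u v uv = (enc u , enc v) , edge uv

  connected-via-root : (r : V) → (∀ u → Walk graph (enc u) (enc r)) → Connected graph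
  connected-via-root r to-r =
    connected-via graph (enc r) λ x → subst (λ y → Walk graph y (enc r)) (enc-dec x) (to-r (dec x))

  admissible-if-two-neighbours′ :
    (∀ u → ∃₂ λ v w → u ~ v ≡ true × u ~ w ≡ true × v ≢ w) → EdgeDetAdmissible graph
  admissible-if-two-neighbours′ nbrs = admissible-if-two-neighbours graph λ x →
    let v , w , xv , xw , v≢w = nbrs (dec x)
    in enc v , enc w , adj-enc x v xv , adj-enc x w xw , λ eq → v≢w (enc-injective eq)

  record Involution : Set where
    field
      apply      : V → V
      involutive : ∀ u → apply (apply u) ≡ u
      preserves  : ∀ u v → apply u ~ apply v ≡ u ~ v

  module _ (f : Involution) where
    open Involution f

    automorphism : Aut graph
    automorphism = record
      { fun     = fun′
      ; inv     = fun′
      ; inv-l   = involutive′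
      ; inv-r   = involutive′
      ; preserv = λ x y → trans (cong₂ _~_ (dec-enc _) (dec-enc _)) (preserves (dec x) (dec y))
      }
      where
      fun′ : Fin n → Fin n
      fun′ x = enc (apply (dec x))

      involutive′ : ∀ x → fun′ (fun′ x) ≡ x
      involutive′ x = trans (cong (λ u → enc (apply u)) (dec-enc _))
                            (trans (cong enc (involutive (dec x))) (enc-dec x))

    automorphism-fixes : ∀ x → apply (dec x) ≡ dec x → fun automorphism x ≡ x
    automorphism-fixes x fixed = trans (cong enc fixed) (enc-dec x)

    automorphism-non-identity : ∀ u → apply u ≢ u → ¬ IsIdentity graph automorphism
    automorphism-non-identity u moved identity = moved (begin
      apply u                         ≡⟨ cong apply (sym (dec-enc u)) ⟩
      apply (dec (enc u))             ≡⟨ sym (dec-enc _) ⟩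
      dec (fun automorphism (enc u))  ≡⟨ cong dec (identity (enc u)) ⟩
      dec (enc u)                     ≡⟨ dec-enc u ⟩
      u                               ∎)
      where open ≡-Reasoning

  module _ (φ : Aut graph) where

    act : V → V
    act u = dec (fun φ (enc u))

    act-injective : ∀ {u v} → act u ≡ act v → u ≡ v
    act-injective {u} {v} eq = enc-injective (begin
      enc u                       ≡⟨ sym (inv-l φ (enc u)) ⟩
      inv φ (fun φ (enc u))       ≡⟨ cong (inv φ) (sym (enc-dec _)) ⟩
      inv φ (enc (act u))         ≡⟨ cong (λ w → inv φ (enc w)) eq ⟩
      inv φ (enc (act v))         ≡⟨ cong (inv φ) (enc-dec _) ⟩
      inv φ (fun φ (enc v))       ≡⟨ inv-l φ (enc v) ⟩
      enc v                       ∎)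
      where open ≡-Reasoning

    act-preserves : ∀ u v → act u ~ act v ≡ u ~ v
    act-preserves u v = trans (preserv φ (enc u) (enc v)) (cong₂ _~_ (dec-enc u) (dec-enc v))

    act-maps : ∀ u v → fun φ (enc u) ≡ enc v → act u ≡ v
    act-maps u v u↦v = trans (cong dec u↦v) (dec-enc v)

    act-fixes : ∀ u → fun φ (enc u) ≡ enc u → act u ≡ u
    act-fixes u = act-maps u u

    identity-if-act-identity : (∀ u → act u ≡ u) → IsIdentity graph φ
    identity-if-act-identity fixed x = begin
      fun φ x                     ≡⟨ cong (fun φ) (sym (enc-dec x)) ⟩
      fun φ (enc (dec x))         ≡⟨ sym (enc-dec _) ⟩
      enc (act (dec x))           ≡⟨ cong enc (fixed (dec x)) ⟩
      enc (dec x)                 ≡⟨ enc-dec x ⟩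
      x                           ∎
      where open ≡-Reasoning

data Side : Set where
  ₁ ₂ : Side

opposite : Side → Side
opposite ₁ = ₂
opposite ₂ = ₁

opposite-involutive : ∀ x → opposite (opposite x) ≡ x
opposite-involutive ₁ = refl
opposite-involutive ₂ = refl

_==_ : Side → Side → Bool
₁ == ₁ = true
₂ == ₂ = true
_ == _ = false

==-sym : ∀ x y → (x == y) ≡ (y == x)
==-sym ₁ ₁ = refl
==-sym ₁ ₂ = refl
==-sym ₂ ₁ = refl
==-sym ₂ ₂ = refl

==-refl : ∀ x → (x == x) ≡ true
==-refl ₁ = refl
==-refl ₂ = refl

==-sound : ∀ {x y} → (x == y) ≡ true → x ≡ y
==-sound {₁} {₁} _ = refl
==-sound {₂} {₂} _ = refl

opposite-== : ∀ x y → (opposite x == opposite y) ≡ (x == y)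
opposite-== ₁ ₁ = refl
opposite-== ₁ ₂ = refl
opposite-== ₂ ₁ = refl
opposite-== ₂ ₂ = refl

data Local : Set where
  a b c : Side → Local

linked : Local → Local → Bool
linked (a x) (b y) = true
linked (b x) (a y) = true
linked (a x) (c y) = x == y
linked (c x) (a y) = x == y
linked _     _     = false

linked-sym : ∀ s t → linked s t ≡ linked t s
linked-sym (a x) (a y) = refl
linked-sym (a x) (b y) = refl
linked-sym (a x) (c y) = ==-sym x y
linked-sym (b x) (a y) = refl
linked-sym (b x) (b y) = refl
linked-sym (b x) (c y) = refl
linked-sym (c x) (a y) = ==-sym x y
linked-sym (c x) (b y) = refl
linked-sym (c x) (c y) = refl

linked-irrefl : ∀ s → linked s s ≡ false
linked-irrefl (a x) = refl
linked-irrefl (b x) = refl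
linked-irrefl (c x) = refl

hub-linked : Local → Bool
hub-linked (c x) = true
hub-linked _     = false

record LocalSymmetry : Set where
  field
    apply             : Local → Local
    involutive        : ∀ s → apply (apply s) ≡ s
    preserves-linked     : ∀ s t → linked (apply s) (apply t) ≡ linked s t
    preserves-hub-linked : ∀ s → hub-linked (apply s) ≡ hub-linked s

flip-ac : Local → Local
flip-ac (a x) = a (opposite x)
flip-ac (b x) = b x
flip-ac (c x) = c (opposite x)

flip-ac-involutive : ∀ s → flip-ac (flip-ac s) ≡ s
flip-ac-involutive (a x) = cong a (opposite-involutive x)
flip-ac-involutive (b x) = refl
flip-ac-involutive (c x) = cong c (opposite-involutive x)

flip-ac-linked : ∀ s t → linked (flip-ac s) (flip-ac t) ≡ linked s t
flip-ac-linked (a x) (a y) = refl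
flip-ac-linked (a x) (b y) = refl
flip-ac-linked (a x) (c y) = opposite-== x y
flip-ac-linked (b x) (a y) = refl
flip-ac-linked (b x) (b y) = refl
flip-ac-linked (b x) (c y) = refl
flip-ac-linked (c x) (a y) = opposite-== x y
flip-ac-linked (c x) (b y) = refl
flip-ac-linked (c x) (c y) = refl

flip-ac-hub-linked : ∀ s → hub-linked (flip-ac s) ≡ hub-linked s
flip-ac-hub-linked (a x) = refl
flip-ac-hub-linked (b x) = refl
flip-ac-hub-linked (c x) = refl

flip-b : Local → Local
flip-b (a x) = a x
flip-b (b x) = b (opposite x)
flip-b (c x) = c x

flip-b-involutive : ∀ s → flip-b (flip-b s) ≡ s
flip-b-involutive (a x) = refl
flip-b-involutive (b x) = cong b (opposite-involutive x)
flip-b-involutive (c x) = refl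

flip-b-linked : ∀ s t → linked (flip-b s) (flip-b t) ≡ linked s t
flip-b-linked (a x) (a y) = refl
flip-b-linked (a x) (b y) = refl
flip-b-linked (a x) (c y) = refl
flip-b-linked (b x) (a y) = refl
flip-b-linked (b x) (b y) = refl
flip-b-linked (b x) (c y) = refl
flip-b-linked (c x) (a y) = refl
flip-b-linked (c x) (b y) = refl
flip-b-linked (c x) (c y) = refl

flip-b-hub-linked : ∀ s → hub-linked (flip-b s) ≡ hub-linked s
flip-b-hub-linked (a x) = refl
flip-b-hub-linked (b x) = refl
flip-b-hub-linked (c x) = refl

swap-ac : LocalSymmetry
swap-ac = record
  { apply = flip-ac ; involutive = flip-ac-involutive
  ; preserves-linked = flip-ac-linked ; preserves-hub-linked = flip-ac-hub-linked }

swap-b : LocalSymmetry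
swap-b = record
  { apply = flip-b ; involutive = flip-b-involutive
  ; preserves-linked = flip-b-linked ; preserves-hub-linked = flip-b-hub-linked }

local-code : Local ↔ Fin 6
local-code = mk↔ₛ′ position local position-local local-position
  where
  position : Local → Fin 6
  position (a ₁) = 0F
  position (a ₂) = 1F
  position (b ₁) = 2F
  position (b ₂) = 3F
  position (c ₁) = 4F
  position (c ₂) = 5F

  local : Fin 6 → Local
  local 0F = a ₁
  local 1F = a ₂
  local 2F = b ₁
  local 3F = b ₂
  local 4F = c ₁
  local 5F = c ₂

  position-local : ∀ k → position (local k) ≡ k
  position-local 0F = refl
  position-local 1F = refl
  position-local 2F = refl
  position-local 3F = refl
  position-local 4F = refl
  position-local 5F = refl

  local-position : ∀ s → local (position s) ≡ s
  local-position (a ₁) = refl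
  local-position (a ₂) = refl
  local-position (b ₁) = refl
  local-position (b ₂) = refl
  local-position (c ₁) = refl
  local-position (c ₂) = refl

module Construction (m : ℕ) where

  data Vertex : Set where
    hub  : Vertex
    node : Fin m → Local → Vertex

  vertex-code : Vertex ↔ Fin (suc (m * 6))
  vertex-code = mk↔ₛ′ enc dec enc-dec dec-enc
    where
    open Inverse local-code using (to; from; strictlyInverseˡ; strictlyInverseʳ)

    enc : Vertex → Fin (suc (m * 6))
    enc hub        = zero
    enc (node i s) = suc (combine i (to s))

    dec : Fin (suc (m * 6)) → Vertex
    dec zero    = hub
    dec (suc k) = uncurry (λ i l → node i (from l)) (remQuot 6 k)

    enc-dec : ∀ k → enc (dec k) ≡ k
    enc-dec zero    = refl
    enc-dec (suc k) = cong suc (trans (enc-node (remQuot {m} 6 k)) (combine-remQuot {m} 6 k))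
      where
      enc-node : ∀ p → combine (proj₁ p) (to (from (proj₂ p))) ≡ uncurry combine p
      enc-node (i , l) = cong (combine i) (strictlyInverseˡ l)

    dec-enc : ∀ v → dec (enc v) ≡ v
    dec-enc hub        = refl
    dec-enc (node i s) =
      trans (cong (uncurry (λ i l → node i (from l))) (remQuot-combine i (to s)))
            (cong (node i) (strictlyInverseʳ s))

  same-gadget-sym : ∀ (i j : Fin m) → does (i ≟ j) ≡ does (j ≟ i)
  same-gadget-sym i j with i ≟ j | j ≟ i
  ... | yes _    | yes _   = refl
  ... | no _     | no _    = refl
  ... | yes i≡j  | no j≢i  = contradiction (sym i≡j) j≢i
  ... | no i≢j   | yes j≡i = contradiction (sym j≡i) i≢j

  _~_ : Vertex → Vertex → Bool
  hub      ~ hub      = false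
  hub      ~ node j t = hub-linked t
  node i s ~ hub      = hub-linked s
  node i s ~ node j t = linked s t ∧ does (i ≟ j)

  ~-sym : ∀ u v → u ~ v ≡ v ~ u
  ~-sym hub        hub        = refl
  ~-sym hub        (node j t) = refl
  ~-sym (node i s) hub        = refl
  ~-sym (node i s) (node j t) = cong₂ _∧_ (linked-sym s t) (same-gadget-sym i j)

  ~-irrefl : ∀ u → u ~ u ≡ false
  ~-irrefl hub        = refl
  ~-irrefl (node i s) = cong (_∧ _) (linked-irrefl s)

  open FiniteGraph vertex-code _~_ ~-sym ~-irrefl public

  local-adj : ∀ i s t → linked s t ≡ true → node i s ~ node i t ≡ true
  local-adj i s t st with i ≟ i
  ... | yes _  = trans (∧-identityʳ (linked s t)) st
  ... | no i≢i = contradiction refl i≢i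

  module _ (i : Fin m) (g : LocalSymmetry) where
    open LocalSymmetry g

    at : Fin m → Local → Local
    at j with j ≟ i
    ... | yes _ = apply
    ... | no _  = λ s → s

    at-involutive : ∀ j s → at j (at j s) ≡ s
    at-involutive j s with j ≟ i
    ... | yes _ = involutive s
    ... | no _  = refl

    at-linked : ∀ j s t → linked (at j s) (at j t) ≡ linked s t
    at-linked j s t with j ≟ i
    ... | yes _ = preserves-linked s t
    ... | no _  = refl

    at-hub-linked : ∀ j s → hub-linked (at j s) ≡ hub-linked s
    at-hub-linked j s with j ≟ i
    ... | yes _ = preserves-hub-linked s
    ... | no _  = refl

    at-gadget : ∀ s → at i s ≡ apply s
    at-gadget s with i ≟ i
    ... | yes _  = refl
    ... | no i≢i = contradiction refl i≢i

    at-elsewhere : ∀ {j} s → j ≢ i → at j s ≡ s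
    at-elsewhere {j} s j≢i with j ≟ i
    ... | yes j≡i = contradiction j≡i j≢i
    ... | no _    = refl

    at-fixed : ∀ j {s} → apply s ≡ s → at j s ≡ s
    at-fixed j fixed with j ≟ i
    ... | yes _ = fixed
    ... | no _  = refl

    on-gadget : Vertex → Vertex
    on-gadget hub        = hub
    on-gadget (node j s) = node j (at j s)

    on-gadget-preserves : ∀ u v → on-gadget u ~ on-gadget v ≡ u ~ v
    on-gadget-preserves hub        hub        = refl
    on-gadget-preserves hub        (node k t) = at-hub-linked k t
    on-gadget-preserves (node j s) hub        = at-hub-linked j s
    on-gadget-preserves (node j s) (node k t) with j ≟ k
    ... | yes refl = cong (_∧ true) (at-linked j s t)
    ... | no _     = trans (∧-zeroʳ _) (sym (∧-zeroʳ _))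

    gadget-symmetry : Involution
    gadget-symmetry = record
      { apply      = on-gadget
      ; involutive = λ { hub → refl ; (node j s) → cong (node j) (at-involutive j s) }
      ; preserves  = on-gadget-preserves
      }

  data Neighbour (i : Fin m) (s : Local) : Vertex → Set where
    hub-neighbour   : hub-linked s ≡ true → Neighbour i s hub
    local-neighbour : ∀ {t} → linked s t ≡ true → Neighbour i s (node i t)

  neighbour : ∀ {i s v} → node i s ~ v ≡ true → Neighbour i s v
  neighbour {v = hub} sv = hub-neighbour sv
  neighbour {i} {s} {node j t} sv with i ≟ j
  ... | yes refl = local-neighbour (trans (sym (∧-identityʳ (linked s t))) sv)
  ... | no _     = contradiction (trans (sym (∧-zeroʳ (linked s t))) sv) λ ()

  a-neighbours : ∀ {i x v} → node i (a x) ~ v ≡ true →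
                 v ≡ node i (b ₁) ⊎ v ≡ node i (b ₂) ⊎ v ≡ node i (c x)
  a-neighbours {i} {x} {v} av with neighbour {i} {a x} {v} av
  ... | local-neighbour {b ₁} _ = inj₁ refl
  ... | local-neighbour {b ₂} _ = inj₂ (inj₁ refl)
  ... | local-neighbour {c _} x≡y = inj₂ (inj₂ (cong (λ y → node _ (c y)) (sym (==-sound x≡y))))
  ... | local-neighbour {a _} ()
  ... | hub-neighbour ()

  b-neighbours : ∀ {i x v} → node i (b x) ~ v ≡ true → v ≡ node i (a ₁) ⊎ v ≡ node i (a ₂)
  b-neighbours {i} {x} {v} bv with neighbour {i} {b x} {v} bv
  ... | local-neighbour {a ₁} _ = inj₁ refl
  ... | local-neighbour {a ₂} _ = inj₂ refl
  ... | local-neighbour {b _} ()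
  ... | local-neighbour {c _} ()
  ... | hub-neighbour ()

  c-neighbours : ∀ {i x v} → node i (c x) ~ v ≡ true → v ≡ hub ⊎ v ≡ node i (a x)
  c-neighbours {i} {x} {v} cv with neighbour {i} {c x} {v} cv
  ... | hub-neighbour _          = inj₁ refl
  ... | local-neighbour {a _} x≡y = inj₂ (cong (λ y → node _ (a y)) (sym (==-sound x≡y)))
  ... | local-neighbour {b _} ()
  ... | local-neighbour {c _} ()

  module Rigidity (ψ : Vertex → Vertex) (ψ-injective : ∀ {u v} → ψ u ≡ ψ v → u ≡ v)
                  (ψ-preserves : ∀ u v → ψ u ~ ψ v ≡ u ~ v) where

    image-adj : ∀ {u v u′} → ψ u ≡ u′ → u ~ v ≡ true → u′ ~ ψ v ≡ true
    image-adj {u} {v} refl uv = trans (ψ-preserves u v) uv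

    image-local : ∀ {i s u′} t → ψ (node i s) ≡ u′ → linked s t ≡ true → u′ ~ ψ (node i t) ≡ true
    image-local {i} {s} t ψs≡u′ st = image-adj ψs≡u′ (local-adj i s t st)

    collide : ∀ {u v w} → ψ u ≡ w → ψ v ≡ w → u ≡ v
    collide ψu≡w ψv≡w = ψ-injective (trans ψu≡w (sym ψv≡w))

    no-swap : ∀ i → ψ (node i (a ₁)) ≡ node i (b ₁) → ψ (node i (b ₁)) ≡ node i (a ₁) → ⊥
    no-swap i a₁↦b₁ b₁↦a₁ with b-neighbours (image-local (c ₁) a₁↦b₁ refl)
    ... | inj₁ c₁↦a₁ = contradiction (collide c₁↦a₁ b₁↦a₁) λ ()
    ... | inj₂ c₁↦a₂ with b-neighbours (image-local (b ₂) a₁↦b₁ refl)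
    ...   | inj₁ b₂↦a₁ = contradiction (collide b₂↦a₁ b₁↦a₁) λ ()
    ...   | inj₂ b₂↦a₂ = contradiction (collide b₂↦a₂ c₁↦a₂) λ ()

    module _ (i₀ : Fin m) (fixes-a₁ : ∀ i → ψ (node i (a ₁)) ≡ node i (a ₁))
             (fixes-b₁ : ∀ i → ψ (node i (b ₁)) ≡ node i (b ₁)) where

      fixes-a₂ : ∀ i → ψ (node i (a ₂)) ≡ node i (a ₂)
      fixes-a₂ i with b-neighbours (image-local (a ₂) (fixes-b₁ i) refl)
      ... | inj₁ a₂↦a₁ = contradiction (collide a₂↦a₁ (fixes-a₁ i)) λ ()
      ... | inj₂ a₂↦a₂ = a₂↦a₂

      fixes-b₂ : ∀ i → ψ (node i (b ₂)) ≡ node i (b ₂)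
      fixes-b₂ i with a-neighbours (image-local (b ₂) (fixes-a₁ i) refl)
      ... | inj₁ b₂↦b₁          = contradiction (collide b₂↦b₁ (fixes-b₁ i)) λ ()
      ... | inj₂ (inj₁ b₂↦b₂)   = b₂↦b₂
      ... | inj₂ (inj₂ b₂↦c₁)   =
        contradiction (subst (λ v → node i (a ₂) ~ v ≡ true) b₂↦c₁
                        (image-local (b ₂) (fixes-a₂ i) refl)) λ ()

      fixes-a : ∀ i x → ψ (node i (a x)) ≡ node i (a x)
      fixes-a i ₁ = fixes-a₁ i
      fixes-a i ₂ = fixes-a₂ i

      fixes-c : ∀ i x → ψ (node i (c x)) ≡ node i (c x)
      fixes-c i x with a-neighbours (image-local (c x) (fixes-a i x) (==-refl x))
      ... | inj₁ c↦b₁        = contradiction (collide c↦b₁ (fixes-b₁ i)) λ ()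
      ... | inj₂ (inj₁ c↦b₂) = contradiction (collide c↦b₂ (fixes-b₂ i)) λ ()
      ... | inj₂ (inj₂ c↦c)  = c↦c

      fixes-hub : ψ hub ≡ hub
      fixes-hub with c-neighbours (image-adj (fixes-c i₀ ₁) refl)
      ... | inj₁ hub↦hub = hub↦hub
      ... | inj₂ hub↦a₁  = contradiction (collide hub↦a₁ (fixes-a₁ i₀)) λ ()

      rigid : ∀ u → ψ u ≡ u
      rigid hub            = fixes-hub
      rigid (node i (a x)) = fixes-a i x
      rigid (node i (b ₁)) = fixes-b₁ i
      rigid (node i (b ₂)) = fixes-b₂ i
      rigid (node i (c x)) = fixes-c i x

  node-injective : ∀ {i s t} → node i s ≡ node i t → s ≡ t
  node-injective refl = refl

  module _ (i : Fin m) (g : LocalSymmetry) where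
    open LocalSymmetry g

    on-gadget-fixes : ∀ j s → j ≢ i ⊎ apply s ≡ s → on-gadget i g (node j s) ≡ node j s
    on-gadget-fixes j s (inj₁ j≢i)   = cong (node j) (at-elsewhere i g s j≢i)
    on-gadget-fixes j s (inj₂ fixed) = cong (node j) (at-fixed i g j fixed)

    gadget-automorphism-non-identity :
      ∀ s → apply s ≢ s → ¬ IsIdentity graph (automorphism (gadget-symmetry i g))
    gadget-automorphism-non-identity s moved = automorphism-non-identity (gadget-symmetry i g) (node i s)
      λ fixed → moved (trans (sym (at-gadget i g s)) (node-injective fixed))

  connected : Connected graph
  connected = connected-via-root hub to-hub
    where
    to-hub : ∀ u → Walk graph (enc u) (enc hub)
    to-hub hub            = here
    to-hub (node i (c x)) = via (node i (c x)) hub refl here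
    to-hub (node i (a x)) =
      via (node i (a x)) (node i (c x)) (local-adj i (a x) (c x) (==-refl x)) (via (node i (c x)) hub refl here)
    to-hub (node i (b x)) =
      via (node i (b x)) (node i (a ₁)) (local-adj i (b x) (a ₁) refl) (
      via (node i (a ₁)) (node i (c ₁)) (local-adj i (a ₁) (c ₁) refl) (via (node i (c ₁)) hub refl here))

  admissible : Fin m → EdgeDetAdmissible graph
  admissible i₀ = admissible-if-two-neighbours′ two-neighbours
    where
    two-neighbours : ∀ u → ∃₂ λ v w → u ~ v ≡ true × u ~ w ≡ true × v ≢ w
    two-neighbours hub            = node i₀ (c ₁) , node i₀ (c ₂) , refl , refl , λ ()
    two-neighbours (node i (a x)) = node i (b ₁) , node i (b ₂)
      , local-adj i (a x) (b ₁) refl , local-adj i (a x) (b ₂) refl , λ ()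
    two-neighbours (node i (b x)) = node i (a ₁) , node i (a ₂)
      , local-adj i (b x) (a ₁) refl , local-adj i (b x) (a ₂) refl , λ ()
    two-neighbours (node i (c x)) = hub , node i (a x)
      , refl , local-adj i (c x) (a x) (==-refl x) , λ ()

  module _ (φ : Aut graph) where
    open Rigidity (act φ) (act-injective φ) (act-preserves φ) public

  a₁-vertices b₁-vertices : List (Fin (order graph))
  a₁-vertices = tabulate λ i → enc (node i (a ₁))
  b₁-vertices = tabulate λ i → enc (node i (b ₁))

  determining-vertices : List (Fin (order graph))
  determining-vertices = a₁-vertices ++ b₁-vertices

  determining-vertices-length : length determining-vertices ≡ m + m
  determining-vertices-length =
    trans (length-++ a₁-vertices) (cong₂ _+_ (length-tabulate {n = m} _) (length-tabulate {n = m} _))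

  vertex-determining : Fin m → VertexDetermining graph determining-vertices
  vertex-determining i₀ φ fixed = identity-if-act-identity φ (rigid φ i₀
    (λ i → act-fixes φ (node i (a ₁)) (tabulate⁻ (++⁻ˡ a₁-vertices fixed) i))
    (λ i → act-fixes φ (node i (b ₁)) (tabulate⁻ (++⁻ʳ a₁-vertices fixed) i)))

  determining-edges : List (Edge graph)
  determining-edges = tabulate λ i → edge-of (node i (a ₁)) (node i (b ₁)) (local-adj i (a ₁) (b ₁) refl)

  determining-edges-length : length determining-edges ≡ m
  determining-edges-length = length-tabulate _

  edge-determining : Fin m → EdgeDetermining graph determining-edges
  edge-determining i₀ φ fixed = identity-if-act-identity φ
    (rigid φ i₀ (λ i → proj₁ (ends-fixed i)) (λ i → proj₂ (ends-fixed i)))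
    where
    ends-fixed : ∀ i → act φ (node i (a ₁)) ≡ node i (a ₁) × act φ (node i (b ₁)) ≡ node i (b ₁)
    ends-fixed i with tabulate⁻ fixed i
    ... | inj₁ (a₁↦a₁ , b₁↦b₁) =
      act-fixes φ (node i (a ₁)) a₁↦a₁ , act-fixes φ (node i (b ₁)) b₁↦b₁
    ... | inj₂ (a₁↦b₁ , b₁↦a₁) = contradiction
      (act-maps φ (node i (b ₁)) (node i (a ₁)) b₁↦a₁) (no-swap φ i (act-maps φ (node i (a ₁)) (node i (b ₁)) a₁↦b₁))

  -- No gadget symmetry moves the hub, so it gets the out-of-range class m + m.
  owner : Vertex → ℕ
  owner hub            = m + m
  owner (node i (b _)) = m + toℕ i
  owner (node i _)     = toℕ i

  swap-ac-fixes : ∀ i u → owner u ≢ toℕ i → on-gadget i swap-ac u ≡ u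
  swap-ac-fixes i hub            _ = refl
  swap-ac-fixes i (node j (a x)) j≢i = on-gadget-fixes i swap-ac j (a x) (inj₁ (j≢i ∘ cong toℕ))
  swap-ac-fixes i (node j (b x)) _   = on-gadget-fixes i swap-ac j (b x) (inj₂ refl)
  swap-ac-fixes i (node j (c x)) j≢i = on-gadget-fixes i swap-ac j (c x) (inj₁ (j≢i ∘ cong toℕ))

  swap-b-fixes : ∀ i u → owner u ≢ m + toℕ i → on-gadget i swap-b u ≡ u
  swap-b-fixes i hub            _   = refl
  swap-b-fixes i (node j (a x)) _   = on-gadget-fixes i swap-b j (a x) (inj₂ refl)
  swap-b-fixes i (node j (b x)) j≢i = on-gadget-fixes i swap-b j (b x) (inj₁ (j≢i ∘ cong (λ k → m + toℕ k)))
  swap-b-fixes i (node j (c x)) _   = on-gadget-fixes i swap-b j (c x) (inj₂ refl)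

  vertex-lower-bound : ∀ S → VertexDetermining graph S → m + m ≤ length S
  vertex-lower-bound = determining-lower-bound graph (λ α x → fun α x ≡ x) (owner ∘ dec) (m + m) moving
    where
    moving : ∀ (j : Fin (m + m)) → Σ (Aut graph) λ α →
             ¬ IsIdentity graph α × (∀ x → owner (dec x) ≢ toℕ j → fun α x ≡ x)
    moving j with splitAt m j in split
    ... | inj₁ i = automorphism (gadget-symmetry i swap-ac)
                 , gadget-automorphism-non-identity i swap-ac (a ₁) (λ ())
                 , λ x x∉j → automorphism-fixes (gadget-symmetry i swap-ac) x
                               (swap-ac-fixes i (dec x) (λ owned → x∉j (trans owned toℕ-j)))
      where
      toℕ-j : toℕ i ≡ toℕ j
      toℕ-j = trans (sym (toℕ-↑ˡ i m)) (cong toℕ (splitAt⁻¹-↑ˡ split))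
    ... | inj₂ i = automorphism (gadget-symmetry i swap-b)
                 , gadget-automorphism-non-identity i swap-b (b ₁) (λ ())
                 , λ x x∉j → automorphism-fixes (gadget-symmetry i swap-b) x
                               (swap-b-fixes i (dec x) (λ owned → x∉j (trans owned toℕ-j)))
      where
      toℕ-j : m + toℕ i ≡ toℕ j
      toℕ-j = trans (sym (toℕ-↑ʳ m i)) (cong toℕ (splitAt⁻¹-↑ʳ split))

  -- An edge meets the b-vertices of at most one gadget, since they are adjacent only to a-vertices.
  b-owner : Vertex → ℕ → ℕ
  b-owner (node i (b _)) _ = toℕ i
  b-owner _              d = d

  swap-b-fixes-unless-b-owner : ∀ i u d → b-owner u d ≢ toℕ i → on-gadget i swap-b u ≡ u
  swap-b-fixes-unless-b-owner i hub            _ _   = refl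
  swap-b-fixes-unless-b-owner i (node j (a x)) _ _   = on-gadget-fixes i swap-b j (a x) (inj₂ refl)
  swap-b-fixes-unless-b-owner i (node j (b x)) _ j≢i = on-gadget-fixes i swap-b j (b x) (inj₁ (j≢i ∘ cong toℕ))
  swap-b-fixes-unless-b-owner i (node j (c x)) _ _   = on-gadget-fixes i swap-b j (c x) (inj₂ refl)

  swap-b-fixes-edge : ∀ i u v → u ~ v ≡ true → b-owner u (b-owner v m) ≢ toℕ i →
                      on-gadget i swap-b u ≡ u × on-gadget i swap-b v ≡ v
  swap-b-fixes-edge i u@(node j (b x)) v uv owned =
    swap-b-fixes-unless-b-owner i u (b-owner v m) owned , a-fixed (b-neighbours {j} {x} {v} uv)
    where
    a-fixed : v ≡ node j (a ₁) ⊎ v ≡ node j (a ₂) → on-gadget i swap-b v ≡ v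
    a-fixed (inj₁ refl) = on-gadget-fixes i swap-b j (a ₁) (inj₂ refl)
    a-fixed (inj₂ refl) = on-gadget-fixes i swap-b j (a ₂) (inj₂ refl)
  swap-b-fixes-edge i hub              v _ owned = refl , swap-b-fixes-unless-b-owner i v m owned
  swap-b-fixes-edge i u@(node j (a x)) v _ owned =
    swap-b-fixes-unless-b-owner i u (b-owner v m) owned , swap-b-fixes-unless-b-owner i v m owned
  swap-b-fixes-edge i u@(node j (c x)) v _ owned =
    swap-b-fixes-unless-b-owner i u (b-owner v m) owned , swap-b-fixes-unless-b-owner i v m owned

  edge-owner : Edge graph → ℕ
  edge-owner ((x , y) , _) = b-owner (dec x) (b-owner (dec y) m)

  edge-lower-bound : ∀ T → EdgeDetermining graph T → m ≤ length T
  edge-lower-bound = determining-lower-bound graph (FixesEdge graph) edge-owner m moving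
    where
    moving : ∀ (i : Fin m) → Σ (Aut graph) λ α →
             ¬ IsIdentity graph α × (∀ e → edge-owner e ≢ toℕ i → FixesEdge graph α e)
    moving i = automorphism σ , gadget-automorphism-non-identity i swap-b (b ₁) (λ ())
             , λ { ((x , y) , xy) owned →
                   let x-fixed , y-fixed = swap-b-fixes-edge i (dec x) (dec y) xy owned
                   in inj₁ (automorphism-fixes σ x x-fixed , automorphism-fixes σ y y-fixed) }
      where σ = gadget-symmetry i swap-b

theorem9 : ∀ (n : ℕ) → Σ Graph λ G →
    Connected G × EdgeDetAdmissible G × DetEq G (2 * suc n) × EdgeDetEq G (suc n)
theorem9 n =
  graph , connected , admissible zero
  , subst (DetEq graph) m+m≡2*m
      ((determining-vertices , vertex-determining zero , determining-vertices-length) , vertex-lower-bound)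
  , ((determining-edges , edge-determining zero , determining-edges-length) , edge-lower-bound)
  where
  open Construction (suc n)

  m+m≡2*m : suc n + suc n ≡ 2 * suc n
  m+m≡2*m = cong (suc n +_) (sym (+-identityʳ (suc n)))
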